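{- Let $p$ and $q$ be distinct odd primes and $k\geq 3$ an odd integer. Let $S_k(n):=1^k+2^k+\cdots+n^k$, and let \[ A=\{k\in\mathbb{N}: k\not\equiv 1\pmod{p-1}\},\qquad B=\{k\in\mathbb{N}: k\equiv 1\pmod{q-1}\}. \] If $k\in A\setminus B$, then $(pq)^2\mid S_k(pq)$. Furthermore, if $k\in A$, then $(pq)^2\mid d\cdot S_k(pq)$, where \[ d=\begin{cases} q & \text{if } k\equiv 1\pmod{q-1} \text{ and } k\neq q,\\ 1 & \text{otherwise.}\end{cases} \] -}

module Defs where

open import Data.Nat using (ℕ; zero; suc; _+_; _*_; _^_; _∸_)
open import Data.Nat.Divisibility using (_∣_)
open import Relation.Binary.PropositionalEquality using (_≡_)
open import Relation.Nullary using (¬_)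
open import Data.Product using (_×_)
open import Data.Sum using (_⊎_)

S : ℕ → ℕ → ℕ
S k zero = 0
S k (suc n) = S k n + suc n ^ k

-- k ≡ 1 (mod m), for k ≥ 1:  m ∣ (k - 1)
_≡1mod_ : ℕ → ℕ → Set
k ≡1mod m = m ∣ (k ∸ 1)

InA : ℕ → ℕ → Set
InA p k = ¬ (k ≡1mod (p ∸ 1))

InB : ℕ → ℕ → Set
InB q k = k ≡1mod (q ∸ 1)

IsD : ℕ → ℕ → ℕ → Set
IsD q k d = ((k ≡1mod (q ∸ 1)) × ¬ (k ≡ q) × d ≡ q)
          ⊎ (¬ ((k ≡1mod (q ∸ 1)) × ¬ (k ≡ q)) × d ≡ 1)

-- Write P_k(n) = Σ_{a<n} a^k, so that S_k(n) = P_k(n+1). Expanding (jn + a)^k modulo n² block by block gives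
--   P_k(mn) ≡ m P_k(n) + (Σ_{j<m} j) k n P_{k-1}(n)   (mod n²),
-- and pairing a with n − a gives, for odd k,  2 P_k(n+1) ≡ k n P_{k-1}(n+1)  (mod n²).
-- Hence, for odd n and odd k ≥ 3, n ∣ S_k(mn) always, and n² ∣ S_k(mn) as soon as n ∣ k P_{k-1}(n).
-- This condition is trivial for n = k, and holds for an odd prime p with p − 1 ∤ k − 1 because then
-- p ∣ P_{k-1}(p): Fermat's little theorem reduces the exponent modulo p − 1, and for exponents below p − 1
-- the identity Σ_{i<j} C(j,i) P_i(p) = p^j gives it by induction. Combining the information at p² and q²
-- proves the theorem; when d = q, that factor supplies the second power of q.

module Submission where

module _ where

  open import Data.Nat.Base as ℕ using (ℕ; zero; suc; s≤s)
  import Data.Nat.Properties as ℕₚ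
  open import Data.Nat.Combinatorics using (_C_; nCn≡1; nC1≡n; nCk≡nC[n∸k]; nCk+nC[k+1]≡[n+1]C[k+1]; k>n⇒nCk≡0)
  open import Data.Nat.Coprimality using (Coprime; coprime-divisor; prime⇒coprime)
  import Data.Nat.Divisibility as ℕ∣
  open ℕ∣ using () renaming (_∣_ to _∣ℕ_)
  open import Data.Nat.Primality using (Prime)
  open import Data.Nat.DivMod using (_%_; _/_; m≡m%n+[m/n]*n; m%n<n)
  open import Data.Nat.Induction using (<-rec)
  open import Data.Empty using (⊥-elim)
  open import Relation.Nullary using (¬_)
  open import Data.Nat.Tactic.RingSolver as ℕ-Solver using ()
  open import Data.Integer.Base using (ℤ; +_; 0ℤ; 1ℤ; _+_; _-_; -_; _*_; _^_)
  import Data.Integer.Properties as ℤₚ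
  open import Data.Integer.Divisibility.Signed
  open import Data.Integer.Tactic.RingSolver using (solve-∀)
  open import Algebra.Properties.CommutativeSemigroup ℤₚ.+-commutativeSemigroup using (interchange)
  open import Relation.Binary.PropositionalEquality
  open import Defs using (S; InA)
  open ≡-Reasoning

  ∑ : ℕ → (ℕ → ℤ) → ℤ
  ∑ zero    f = 0ℤ
  ∑ (suc n) f = ∑ n f + f n

  syntax ∑ n (λ i → x) = ∑[ i < n ] x

  ∑-cong : ∀ n {f g : ℕ → ℤ} → (∀ i → f i ≡ g i) → ∑ n f ≡ ∑ n g
  ∑-cong zero    f≡g = refl
  ∑-cong (suc n) f≡g = cong₂ _+_ (∑-cong n f≡g) (f≡g n)

  ∑-distrib-+ : ∀ n (f g : ℕ → ℤ) → ∑[ i < n ] (f i + g i) ≡ ∑ n f + ∑ n g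
  ∑-distrib-+ zero    f g = refl
  ∑-distrib-+ (suc n) f g =
    trans (cong (_+ (f n + g n)) (∑-distrib-+ n f g)) (interchange (∑ n f) (∑ n g) (f n) (g n))

  ∑-distrib-- : ∀ n (f g : ℕ → ℤ) → ∑[ i < n ] (f i - g i) ≡ ∑ n f - ∑ n g
  ∑-distrib-- zero    f g = refl
  ∑-distrib-- (suc n) f g =
    trans (cong (_+ (f n - g n)) (∑-distrib-- n f g)) (regroup (∑ n f) (∑ n g) (f n) (g n))
    where
    regroup : ∀ a b c d → a - b + (c - d) ≡ a + c - (b + d)
    regroup = solve-∀

  ∑-*ˡ : ∀ n c (f : ℕ → ℤ) → ∑[ i < n ] (c * f i) ≡ c * ∑ n f
  ∑-*ˡ zero    c f = sym (ℤₚ.*-zeroʳ c)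
  ∑-*ˡ (suc n) c f =
    trans (cong (_+ c * f n) (∑-*ˡ n c f)) (sym (ℤₚ.*-distribˡ-+ c (∑ n f) (f n)))

  ∑-const : ∀ n c → ∑[ i < n ] c ≡ + n * c
  ∑-const zero    c = refl
  ∑-const (suc n) c = begin
    ∑[ i < n ] c + c ≡⟨ cong (_+ c) (∑-const n c) ⟩
    + n * c + c      ≡⟨ ℤₚ.+-comm (+ n * c) c ⟩
    c + + n * c      ≡⟨ ℤₚ.suc-* (+ n) c ⟨
    + suc n * c      ∎

  ∣-∑ : ∀ {d} n (f : ℕ → ℤ) → (∀ i → i ℕ.< n → d ∣ f i) → d ∣ ∑ n f
  ∣-∑ zero    f d∣f = divides 0ℤ refl
  ∣-∑ (suc n) f d∣f =
    ∣m∣n⇒∣m+n (∣-∑ n f (λ i i<n → d∣f i (ℕₚ.m<n⇒m<1+n i<n))) (d∣f n (ℕₚ.n<1+n n))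

  ∑-suc : ∀ n (f : ℕ → ℤ) → ∑ (suc n) f ≡ f 0 + ∑[ i < n ] f (suc i)
  ∑-suc zero    f = ℤₚ.+-comm 0ℤ (f 0)
  ∑-suc (suc n) f =
    trans (cong (_+ f (suc n)) (∑-suc n f)) (ℤₚ.+-assoc (f 0) (∑[ i < n ] f (suc i)) (f (suc n)))

  ∑-+ : ∀ m n (f : ℕ → ℤ) → ∑ (m ℕ.+ n) f ≡ ∑ m f + ∑[ i < n ] f (m ℕ.+ i)
  ∑-+ m zero    f rewrite ℕₚ.+-identityʳ m = sym (ℤₚ.+-identityʳ (∑ m f))
  ∑-+ m (suc n) f rewrite ℕₚ.+-suc m n =
    trans (cong (_+ f (m ℕ.+ n)) (∑-+ m n f)) (ℤₚ.+-assoc (∑ m f) (∑[ i < n ] f (m ℕ.+ i)) (f (m ℕ.+ n)))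

  ∑-comm : ∀ m n (f : ℕ → ℕ → ℤ) → ∑[ i < m ] ∑[ j < n ] f i j ≡ ∑[ j < n ] ∑[ i < m ] f i j
  ∑-comm zero    n f = sym (trans (∑-const n 0ℤ) (ℤₚ.*-zeroʳ (+ n)))
  ∑-comm (suc m) n f =
    trans (cong (_+ ∑[ j < n ] f m j) (∑-comm m n f)) (sym (∑-distrib-+ n (λ j → ∑[ i < m ] f i j) (f m)))

  ∑-reverse : ∀ n (f : ℕ → ℤ) → ∑ (suc n) f ≡ ∑[ i < suc n ] f (n ℕ.∸ i)
  ∑-reverse zero    f = refl
  ∑-reverse (suc n) f = begin
    ∑ (suc n) f + f (suc n)                        ≡⟨ cong (_+ f (suc n)) (∑-reverse n f) ⟩
    ∑[ i < suc n ] f (n ℕ.∸ i) + f (suc n)         ≡⟨ ℤₚ.+-comm (∑[ i < suc n ] f (n ℕ.∸ i)) (f (suc n)) ⟩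
    f (suc n) + ∑[ i < suc n ] f (n ℕ.∸ i)         ≡⟨ ∑-suc (suc n) (λ i → f (suc n ℕ.∸ i)) ⟨
    ∑[ i < suc (suc n) ] f (suc n ℕ.∸ i)           ∎

  ∑-blocks : ∀ m n (f : ℕ → ℤ) → ∑ (m ℕ.* n) f ≡ ∑[ j < m ] ∑[ a < n ] f (j ℕ.* n ℕ.+ a)
  ∑-blocks zero    n f = refl
  ∑-blocks (suc m) n f = begin
    ∑ (n ℕ.+ m ℕ.* n) f                                      ≡⟨ cong (λ l → ∑ l f) (ℕₚ.+-comm n (m ℕ.* n)) ⟩
    ∑ (m ℕ.* n ℕ.+ n) f                                      ≡⟨ ∑-+ (m ℕ.* n) n f ⟩
    ∑ (m ℕ.* n) f + ∑[ a < n ] f (m ℕ.* n ℕ.+ a)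
      ≡⟨ cong (_+ ∑[ a < n ] f (m ℕ.* n ℕ.+ a)) (∑-blocks m n f) ⟩
    ∑[ j < suc m ] ∑[ a < n ] f (j ℕ.* n ℕ.+ a)              ∎

  ∑-telescope : ∀ n (f : ℕ → ℤ) → ∑[ a < n ] (f (suc a) - f a) ≡ f n - f 0
  ∑-telescope zero    f = sym (ℤₚ.+-inverseʳ (f 0))
  ∑-telescope (suc n) f =
    trans (cong (_+ (f (suc n) - f n)) (∑-telescope n f)) (cancel (f (suc n)) (f n) (f 0))
    where
    cancel : ∀ a b c → b - c + (a - b) ≡ a - c
    cancel = solve-∀

  -- Binomial coefficients and Fermat's little theorem

  [n+1]C[k+1]*[k+1]≡[n+1]*nCk : ∀ n k → (suc n C suc k) ℕ.* suc k ≡ suc n ℕ.* (n C k)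
  [n+1]C[k+1]*[k+1]≡[n+1]*nCk zero    zero    = refl
  [n+1]C[k+1]*[k+1]≡[n+1]*nCk zero    (suc k) = refl
  [n+1]C[k+1]*[k+1]≡[n+1]*nCk (suc n) zero    = cong (ℕ._* 1) (nC1≡n (suc (suc n)))
  [n+1]C[k+1]*[k+1]≡[n+1]*nCk (suc n) (suc k) = begin
    (suc (suc n) C suc (suc k)) ℕ.* suc (suc k)     ≡⟨ cong (ℕ._* suc (suc k)) (nCk+nC[k+1]≡[n+1]C[k+1] (suc n) (suc k)) ⟨
    (a ℕ.+ b) ℕ.* suc (suc k)                        ≡⟨ expand a b k ⟩
    a ℕ.* suc k ℕ.+ a ℕ.+ b ℕ.* suc (suc k)
      ≡⟨ cong₂ (λ u v → u ℕ.+ a ℕ.+ v) ([n+1]C[k+1]*[k+1]≡[n+1]*nCk n k) ([n+1]C[k+1]*[k+1]≡[n+1]*nCk n (suc k)) ⟩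
    suc n ℕ.* (n C k) ℕ.+ a ℕ.+ suc n ℕ.* (n C suc k) ≡⟨ collect (n C k) a (n C suc k) n ⟩
    suc n ℕ.* ((n C k) ℕ.+ (n C suc k)) ℕ.+ a        ≡⟨ cong (λ c → suc n ℕ.* c ℕ.+ a) (nCk+nC[k+1]≡[n+1]C[k+1] n k) ⟩
    suc n ℕ.* a ℕ.+ a                                ≡⟨ ℕₚ.+-comm (suc n ℕ.* a) a ⟩
    suc (suc n) ℕ.* a                                ∎
    where
    a = suc n C suc k
    b = suc n C suc (suc k)
    expand : ∀ a b k → (a ℕ.+ b) ℕ.* suc (suc k) ≡ a ℕ.* suc k ℕ.+ a ℕ.+ b ℕ.* suc (suc k)
    expand = ℕ-Solver.solve-∀
    collect : ∀ c a d n → suc n ℕ.* c ℕ.+ a ℕ.+ suc n ℕ.* d ≡ suc n ℕ.* (c ℕ.+ d) ℕ.+ a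
    collect = ℕ-Solver.solve-∀

  [n+1]Cn≡n+1 : ∀ n → suc n C n ≡ suc n
  [n+1]Cn≡n+1 n = begin
    suc n C n             ≡⟨ nCk≡nC[n∸k] (ℕₚ.n≤1+n n) ⟩
    suc n C (suc n ℕ.∸ n) ≡⟨ cong (suc n C_) (ℕₚ.m+n∸n≡m 1 n) ⟩
    suc n C 1             ≡⟨ nC1≡n (suc n) ⟩
    suc n                 ∎

  prime∣pCk : ∀ {p} → Prime p → ∀ i → suc i ℕ.< p → p ∣ℕ p C suc i
  prime∣pCk {zero}  () i
  prime∣pCk {suc n} pr i i<p = coprime-divisor (prime⇒coprime pr i<p) (ℕ∣.divides (n C i) (begin
    suc i ℕ.* (suc n C suc i) ≡⟨ ℕₚ.*-comm (suc i) (suc n C suc i) ⟩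
    (suc n C suc i) ℕ.* suc i ≡⟨ [n+1]C[k+1]*[k+1]≡[n+1]*nCk n i ⟩
    suc n ℕ.* (n C i)         ≡⟨ ℕₚ.*-comm (suc n) (n C i) ⟩
    (n C i) ℕ.* suc n         ∎))

  binomial-theorem : ∀ x n → (1ℤ + x) ^ n ≡ ∑[ i < suc n ] (+ (n C i) * x ^ i)
  binomial-theorem x zero    = refl
  binomial-theorem x (suc n) = begin
    (1ℤ + x) * (1ℤ + x) ^ n                          ≡⟨ cong ((1ℤ + x) *_) (binomial-theorem x n) ⟩
    (1ℤ + x) * B                                      ≡⟨ distrib x B ⟩
    B + x * B                                         ≡⟨ cong (_+ x * B) B≡1+D ⟩
    1ℤ + D + x * B                                    ≡⟨ regroup D (x * B) ⟩
    1ℤ + (x * B + D)                                  ≡⟨ cong (λ s → 1ℤ + (s + D)) (∑-*ˡ (suc n) x c) ⟨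
    1ℤ + (∑[ i < suc n ] (x * c i) + D)
      ≡⟨ cong (_+_ 1ℤ) (∑-distrib-+ (suc n) (λ i → x * c i) (λ i → c (suc i))) ⟨
    1ℤ + ∑[ i < suc n ] (x * c i + c (suc i))         ≡⟨ cong (_+_ 1ℤ) (∑-cong (suc n) pascal) ⟩
    1ℤ + ∑[ i < suc n ] c′ (suc i)                    ≡⟨ ∑-suc (suc n) c′ ⟨
    ∑[ i < suc (suc n) ] c′ i                         ∎
    where
    c c′ : ℕ → ℤ
    c  i = + (n C i) * x ^ i
    c′ i = + (suc n C i) * x ^ i
    B = ∑ (suc n) c
    D = ∑[ i < suc n ] c (suc i)
    B≡1+D : B ≡ 1ℤ + D
    B≡1+D = begin
      B                                   ≡⟨ ∑-suc n c ⟩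
      1ℤ + ∑[ i < n ] c (suc i)           ≡⟨ cong (_+_ 1ℤ) (ℤₚ.+-identityʳ (∑[ i < n ] c (suc i))) ⟨
      1ℤ + (∑[ i < n ] c (suc i) + 0ℤ)
        ≡⟨ cong (λ m → 1ℤ + (∑[ i < n ] c (suc i) + + m * x ^ suc n)) (k>n⇒nCk≡0 (ℕₚ.n<1+n n)) ⟨
      1ℤ + D                              ∎
    pascal : ∀ i → x * c i + c (suc i) ≡ c′ (suc i)
    pascal i = begin
      x * (+ (n C i) * x ^ i) + + (n C suc i) * (x * x ^ i) ≡⟨ rearrange (+ (n C i)) (+ (n C suc i)) x (x ^ i) ⟩
      (+ (n C i) + + (n C suc i)) * (x * x ^ i)            ≡⟨ cong (λ m → + m * (x * x ^ i)) (nCk+nC[k+1]≡[n+1]C[k+1] n i) ⟩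
      c′ (suc i)                                            ∎
      where
      rearrange : ∀ a b x y → x * (a * y) + b * (x * y) ≡ (a + b) * (x * y)
      rearrange = solve-∀
    distrib : ∀ x B → (1ℤ + x) * B ≡ B + x * B
    distrib = solve-∀
    regroup : ∀ D y → 1ℤ + D + y ≡ 1ℤ + (y + D)
    regroup = solve-∀

  binomial-difference : ∀ x n → (1ℤ + x) ^ n - x ^ n ≡ ∑[ i < n ] (+ (n C i) * x ^ i)
  binomial-difference x n = begin
    (1ℤ + x) ^ n - x ^ n                                   ≡⟨ cong (_- x ^ n) (binomial-theorem x n) ⟩
    ∑[ i < n ] (+ (n C i) * x ^ i) + + (n C n) * x ^ n - x ^ n
      ≡⟨ cong (λ m → ∑[ i < n ] (+ (n C i) * x ^ i) + + m * x ^ n - x ^ n) (nCn≡1 n) ⟩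
    ∑[ i < n ] (+ (n C i) * x ^ i) + 1ℤ * x ^ n - x ^ n    ≡⟨ cancel (∑[ i < n ] (+ (n C i) * x ^ i)) (x ^ n) ⟩
    ∑[ i < n ] (+ (n C i) * x ^ i)                         ∎
    where
    cancel : ∀ s y → s + 1ℤ * y - y ≡ s
    cancel = solve-∀

  infix 4 _≡_mod_
  _≡_mod_ : ℤ → ℤ → ℤ → Set
  x ≡ y mod d = d ∣ x - y

  ≡mod-∣ : ∀ {d x y} → x ≡ y mod d → d ∣ y → d ∣ x
  ≡mod-∣ {d} {x} {y} x≡y d∣y = subst (d ∣_) (cancel x y) (∣m∣n⇒∣m+n x≡y d∣y)
    where
    cancel : ∀ x y → x - y + y ≡ x
    cancel = solve-∀

  coprime-divisorℤ : ∀ {p m x} → Coprime p m → + p ∣ + m * x → + p ∣ x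
  coprime-divisorℤ {p} {m} {x} p⊥m p∣mx =
    ∣ᵤ⇒∣ (coprime-divisor p⊥m (subst (p ∣ℕ_) (ℤₚ.abs-* (+ m) x) (∣⇒∣ᵤ p∣mx)))

  fermat : ∀ {p} → Prime p → ∀ a → (+ a) ^ p ≡ + a mod + p
  fermat {zero}  ()
  fermat {suc n} pr zero    = divides 0ℤ refl
  fermat {suc n} pr (suc a) = subst (+ suc n ∣_) (sym split) (∣m∣n⇒∣m+n p∣middle (fermat pr a))
    where
    A = + a
    c : ℕ → ℤ
    c i = + (suc n C i) * A ^ i
    middle = ∑[ i < n ] c (suc i)
    p∣middle : + suc n ∣ middle
    p∣middle = ∣-∑ n (λ i → c (suc i)) (λ i i<n →
      ∣m⇒∣m*n (A ^ suc i) (∣ᵤ⇒∣ {+ suc n} {+ (suc n C suc i)} (prime∣pCk pr i (s≤s i<n))))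
    split : (1ℤ + A) ^ suc n - (1ℤ + A) ≡ middle + (A ^ suc n - A)
    split = begin
      (1ℤ + A) ^ suc n - (1ℤ + A)                     ≡⟨ rearrange ((1ℤ + A) ^ suc n) (A ^ suc n) A ⟩
      ((1ℤ + A) ^ suc n - A ^ suc n) - 1ℤ + (A ^ suc n - A)
        ≡⟨ cong (λ s → s - 1ℤ + (A ^ suc n - A)) (trans (binomial-difference A (suc n)) (∑-suc n c)) ⟩
      1ℤ + middle - 1ℤ + (A ^ suc n - A)               ≡⟨ cong (_+ (A ^ suc n - A)) (cancel middle) ⟩
      middle + (A ^ suc n - A)                         ∎
      where
      rearrange : ∀ z y a → z - (1ℤ + a) ≡ (z - y) - 1ℤ + (y - a)
      rearrange = solve-∀
      cancel : ∀ m → 1ℤ + m - 1ℤ ≡ m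
      cancel = solve-∀

  fermat-coprime : ∀ {p} → Prime p → ∀ a → suc a ℕ.< p → (+ suc a) ^ (p ℕ.∸ 1) ≡ 1ℤ mod + p
  fermat-coprime {zero}  () a
  fermat-coprime {suc n} pr a a<p =
    coprime-divisorℤ (prime⇒coprime pr a<p) (subst (+ suc n ∣_) (factor (+ suc a) ((+ suc a) ^ n)) (fermat pr (suc a)))
    where
    factor : ∀ a y → a * y - a ≡ a * (y - 1ℤ)
    factor = solve-∀

  ^-≡1 : ∀ {d} y t → y ≡ 1ℤ mod d → y ^ t ≡ 1ℤ mod d
  ^-≡1 y zero    y≡1 = divides 0ℤ refl
  ^-≡1 y (suc t) y≡1 = subst (_ ∣_) (telescope y (y ^ t)) (∣m∣n⇒∣m+n (∣n⇒∣m*n y (^-≡1 y t y≡1)) y≡1)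
    where
    telescope : ∀ y z → y * (z - 1ℤ) + (y - 1ℤ) ≡ y * z - 1ℤ
    telescope = solve-∀

  ^-reduce-exponent : ∀ {p} → Prime p → ∀ a r t → a ℕ.< p →
                      (+ a) ^ (suc r ℕ.+ t ℕ.* (p ℕ.∸ 1)) ≡ (+ a) ^ suc r mod + p
  ^-reduce-exponent pr zero    r t a<p = divides 0ℤ refl
  ^-reduce-exponent {p} pr (suc a) r t a<p =
    subst (+ p ∣_) eq (∣n⇒∣m*n (A ^ suc r) (^-≡1 (A ^ (p ℕ.∸ 1)) t (fermat-coprime pr a a<p)))
    where
    A = + suc a
    eq : A ^ suc r * ((A ^ (p ℕ.∸ 1)) ^ t - 1ℤ) ≡ A ^ (suc r ℕ.+ t ℕ.* (p ℕ.∸ 1)) - A ^ suc r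
    eq = begin
      A ^ suc r * ((A ^ (p ℕ.∸ 1)) ^ t - 1ℤ)     ≡⟨ distrib (A ^ suc r) ((A ^ (p ℕ.∸ 1)) ^ t) ⟩
      A ^ suc r * (A ^ (p ℕ.∸ 1)) ^ t - A ^ suc r
        ≡⟨ cong (λ z → A ^ suc r * z - A ^ suc r) (trans (ℤₚ.^-*-assoc A (p ℕ.∸ 1) t) (cong (A ^_) (ℕₚ.*-comm (p ℕ.∸ 1) t))) ⟩
      A ^ suc r * A ^ (t ℕ.* (p ℕ.∸ 1)) - A ^ suc r
        ≡⟨ cong (_- A ^ suc r) (ℤₚ.^-distribˡ-+-* A (suc r) (t ℕ.* (p ℕ.∸ 1))) ⟨
      A ^ (suc r ℕ.+ t ℕ.* (p ℕ.∸ 1)) - A ^ suc r ∎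
      where
      distrib : ∀ x y → x * (y - 1ℤ) ≡ x * y - x
      distrib = solve-∀

  -- Power sums modulo a prime

  -- The sum starts at a = 0, where 0 ^ 0 = 1; S is related to it only for positive exponents.
  powerSum : ℕ → ℕ → ℤ
  powerSum k n = ∑[ a < n ] ((+ a) ^ k)

  powerSum-binomial : ∀ m n → ∑[ i < m ] (+ (m C i) * powerSum i n) ≡ (+ n) ^ m - 0ℤ ^ m
  powerSum-binomial m n = begin
    ∑[ i < m ] (+ (m C i) * powerSum i n)          ≡⟨ ∑-cong m (λ i → ∑-*ˡ n (+ (m C i)) (λ a → (+ a) ^ i)) ⟨
    ∑[ i < m ] ∑[ a < n ] (+ (m C i) * (+ a) ^ i)  ≡⟨ ∑-comm m n (λ i a → + (m C i) * (+ a) ^ i) ⟩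
    ∑[ a < n ] ∑[ i < m ] (+ (m C i) * (+ a) ^ i)  ≡⟨ ∑-cong n (λ a → binomial-difference (+ a) m) ⟨
    ∑[ a < n ] ((+ suc a) ^ m - (+ a) ^ m)         ≡⟨ ∑-telescope n (λ a → (+ a) ^ m) ⟩
    (+ n) ^ m - 0ℤ ^ m                              ∎

  -- In Σ_{i<j+2} C(j+2,i) P_i(p) = p^{j+2}, every term except (j+2) P_{j+1}(p) is divisible by p.
  prime∣powerSum-small : ∀ {p} → Prime p → ∀ j → suc (suc j) ℕ.< p → + p ∣ powerSum (suc j) p
  prime∣powerSum-small {p} pr = <-rec _ step
    where
    step : ∀ j → (∀ {i} → i ℕ.< j → suc (suc i) ℕ.< p → + p ∣ powerSum (suc i) p) →
           suc (suc j) ℕ.< p → + p ∣ powerSum (suc j) p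
    step j IH j+2<p = coprime-divisorℤ (prime⇒coprime pr j+2<p) (subst (+ p ∣_) top≡ (∣m+n∣m⇒∣n p∣total p∣lower))
      where
      c : ℕ → ℤ
      c i = + (suc (suc j) C i) * powerSum i p
      lower = c 0 + ∑[ i < j ] c (suc i)
      p∣total : + p ∣ lower + c (suc j)
      p∣total = subst (+ p ∣_) (sym (trans (cong (_+ c (suc j)) (sym (∑-suc j c))) (powerSum-binomial (suc (suc j)) p)))
                  (∣m∣n⇒∣m-n (∣m⇒∣m*n _ ∣-refl) (divides 0ℤ refl))
      p∣lower : + p ∣ lower
      p∣lower = ∣m∣n⇒∣m+n (∣n⇒∣m*n 1ℤ (subst (+ p ∣_) (sym (∑-const p 1ℤ)) (∣m⇒∣m*n 1ℤ ∣-refl)))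
                          (∣-∑ j (λ i → c (suc i)) (λ i i<j →
                            ∣n⇒∣m*n (+ (suc (suc j) C suc i)) (IH i<j (ℕₚ.<-trans (s≤s (s≤s i<j)) j+2<p))))
      top≡ : c (suc j) ≡ + suc (suc j) * powerSum (suc j) p
      top≡ = cong (λ m → + m * powerSum (suc j) p) ([n+1]Cn≡n+1 (suc j))

  prime∣powerSum : ∀ {p} → Prime p → ∀ e → ¬ (p ℕ.∸ 1 ∣ℕ suc e) → + p ∣ powerSum (suc e) p
  prime∣powerSum {zero}        ()
  prime∣powerSum {suc zero}    ()
  prime∣powerSum {suc (suc n)} pr e ∤e with suc e % suc n in r≡
  ... | zero  = ⊥-elim (∤e (ℕ∣.m%n≡0⇒n∣m (suc e) (suc n) r≡))
  ... | suc j = ≡mod-∣ reduce (prime∣powerSum-small pr j (s≤s j<n))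
    where
    p = suc (suc n)
    t = suc e / suc n
    e≡ : suc e ≡ suc j ℕ.+ t ℕ.* suc n
    e≡ = trans (m≡m%n+[m/n]*n (suc e) (suc n)) (cong (ℕ._+ t ℕ.* suc n) r≡)
    j<n : suc j ℕ.< suc n
    j<n = subst (ℕ._< suc n) r≡ (m%n<n (suc e) (suc n))
    reduce : powerSum (suc e) p ≡ powerSum (suc j) p mod + p
    reduce = subst (+ p ∣_) (∑-distrib-- p (λ a → (+ a) ^ suc e) (λ a → (+ a) ^ suc j))
      (∣-∑ p _ (λ a a<p → subst (λ k → (+ a) ^ k ≡ (+ a) ^ suc j mod + p) (sym e≡) (^-reduce-exponent pr a j t a<p)))

  -- Power sums modulo a square

  binomial-mod-square : ∀ a n j k → (a + n * j) ^ suc k ≡ a ^ suc k + + suc k * n * j * a ^ k mod n * n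
  binomial-mod-square a n j zero    = divides 0ℤ (linear a n j)
    where
    linear : ∀ a n j → (a + n * j) * 1ℤ - (a * 1ℤ + 1ℤ * n * j * 1ℤ) ≡ 0ℤ * (n * n)
    linear = solve-∀
  binomial-mod-square a n j (suc k) =
    subst (n * n ∣_) (step a n j ((a + n * j) ^ suc k) (a ^ k) (+ suc k))
      (∣m∣n⇒∣m+n (∣n⇒∣m*n (a + n * j) (binomial-mod-square a n j k)) (∣n⇒∣m*n (+ suc k * j * j * a ^ k) ∣-refl))
    where
    step : ∀ a n j x y K → (a + n * j) * (x - (a * y + K * n * j * y)) + K * j * j * y * (n * n)
                         ≡ (a + n * j) * x - (a * (a * y) + (1ℤ + K) * n * j * (a * y))
    step = solve-∀

  neg-^-even : ∀ x h → (- x) ^ (h ℕ.+ h) ≡ x ^ (h ℕ.+ h)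
  neg-^-even x zero    = refl
  neg-^-even x (suc h) rewrite ℕₚ.+-suc h h | neg-^-even x h = square-neg x (x ^ (h ℕ.+ h))
    where
    square-neg : ∀ x y → (- x) * ((- x) * y) ≡ x * (x * y)
    square-neg = solve-∀

  -- Reverse the sum and expand (n − a)^k = (−a + n)^k modulo n².
  powerSum-reflection : ∀ h n → let k = suc (h ℕ.+ h) in
    powerSum k (suc n) + powerSum k (suc n) ≡ + k * + n * powerSum (h ℕ.+ h) (suc n) mod + n * + n
  powerSum-reflection h n = subst (+ n * + n ∣_) sums (∣-∑ (suc n) _ reflected-term)
    where
    k = suc (h ℕ.+ h)
    K = + k
    N = + n
    g : ℕ → ℤ
    g a = K * N * (+ a) ^ (h ℕ.+ h) - (+ a) ^ k
    reflected-term : ∀ a → a ℕ.< suc n → (+ (n ℕ.∸ a)) ^ k ≡ g a mod N * N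
    reflected-term a a<n = subst₂ (λ x y → x ^ k ≡ y mod N * N) base odd-term (binomial-mod-square (- + a) N 1ℤ (h ℕ.+ h))
      where
      base : - + a + N * 1ℤ ≡ + (n ℕ.∸ a)
      base = trans (shift (+ a) N) (trans (ℤₚ.m-n≡m⊖n n a) (ℤₚ.≤-⊖ (ℕₚ.m<1+n⇒m≤n a<n)))
        where
        shift : ∀ a n → - a + n * 1ℤ ≡ n + - a
        shift = solve-∀
      odd-term : (- + a) ^ k + K * N * 1ℤ * (- + a) ^ (h ℕ.+ h) ≡ g a
      odd-term rewrite neg-^-even (+ a) h = flip (+ a) ((+ a) ^ (h ℕ.+ h)) K N
        where
        flip : ∀ a y K N → (- a) * y + K * N * 1ℤ * y ≡ K * N * y - a * y
        flip = solve-∀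
    sums : ∑[ a < suc n ] ((+ (n ℕ.∸ a)) ^ k - g a) ≡ powerSum k (suc n) + powerSum k (suc n) - K * N * powerSum (h ℕ.+ h) (suc n)
    sums = begin
      ∑[ a < suc n ] ((+ (n ℕ.∸ a)) ^ k - g a)  ≡⟨ ∑-distrib-- (suc n) (λ a → (+ (n ℕ.∸ a)) ^ k) g ⟩
      ∑[ a < suc n ] ((+ (n ℕ.∸ a)) ^ k) - ∑ (suc n) g
        ≡⟨ cong₂ _-_ (∑-reverse n (λ a → (+ a) ^ k))
                     (sym (∑-distrib-- (suc n) (λ a → K * N * (+ a) ^ (h ℕ.+ h)) (λ a → (+ a) ^ k))) ⟨
      P - (∑[ a < suc n ] (K * N * (+ a) ^ (h ℕ.+ h)) - P)
        ≡⟨ cong (λ s → P - (s - P)) (∑-*ˡ (suc n) (K * N) (λ a → (+ a) ^ (h ℕ.+ h))) ⟩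
      P - (K * N * P′ - P)                        ≡⟨ rearrange P (K * N * P′) ⟩
      P + P - K * N * P′                          ∎
      where
      P  = powerSum k (suc n)
      P′ = powerSum (h ℕ.+ h) (suc n)
      rearrange : ∀ p q → p - (q - p) ≡ p + p - q
      rearrange = solve-∀

  powerSum-blocks : ∀ k m n → powerSum (suc k) (m ℕ.* n)
                    ≡ + m * powerSum (suc k) n + + suc k * + n * powerSum k n * (∑[ j < m ] (+ j)) mod + n * + n
  powerSum-blocks k m n = subst (+ n * + n ∣_) sums (∣-∑ m _ (λ j _ → ∣-∑ n _ (λ a _ → block-term j a)))
    where
    K = + suc k
    N = + n
    Q = K * N * powerSum k n
    g : ℕ → ℕ → ℤ
    g j a = (+ a) ^ suc k + K * N * + j * (+ a) ^ k
    block-term : ∀ j a → (+ (j ℕ.* n ℕ.+ a)) ^ suc k ≡ g j a mod N * N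
    block-term j a = subst (λ x → x ^ suc k ≡ g j a mod N * N) base (binomial-mod-square (+ a) N (+ j) k)
      where
      base : + a + N * + j ≡ + (j ℕ.* n ℕ.+ a)
      base = begin
        + a + N * + j        ≡⟨ ℤₚ.+-comm (+ a) (N * + j) ⟩
        N * + j + + a        ≡⟨ cong (_+ + a) (ℤₚ.*-comm N (+ j)) ⟩
        + j * N + + a        ≡⟨ cong (_+ + a) (ℤₚ.pos-* j n) ⟨
        + (j ℕ.* n) + + a    ≡⟨ ℤₚ.pos-+ (j ℕ.* n) a ⟨
        + (j ℕ.* n ℕ.+ a)    ∎
    block : ∀ j → ∑ n (g j) ≡ powerSum (suc k) n + Q * + j
    block j = begin
      ∑ n (g j)
        ≡⟨ ∑-distrib-+ n (λ a → (+ a) ^ suc k) (λ a → K * N * + j * (+ a) ^ k) ⟩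
      powerSum (suc k) n + ∑[ a < n ] (K * N * + j * (+ a) ^ k)
        ≡⟨ cong (_+_ (powerSum (suc k) n)) (∑-*ˡ n (K * N * + j) (λ a → (+ a) ^ k)) ⟩
      powerSum (suc k) n + K * N * + j * powerSum k n             ≡⟨ cong (_+_ (powerSum (suc k) n)) (swap K N (+ j) (powerSum k n)) ⟩
      powerSum (suc k) n + Q * + j                                ∎
      where
      swap : ∀ K N j P → K * N * j * P ≡ K * N * P * j
      swap = solve-∀
    sums : ∑[ j < m ] ∑[ a < n ] ((+ (j ℕ.* n ℕ.+ a)) ^ suc k - g j a)
           ≡ powerSum (suc k) (m ℕ.* n) - (+ m * powerSum (suc k) n + Q * (∑[ j < m ] (+ j)))
    sums = begin
      ∑[ j < m ] ∑[ a < n ] ((+ (j ℕ.* n ℕ.+ a)) ^ suc k - g j a)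
        ≡⟨ ∑-cong m (λ j → ∑-distrib-- n (λ a → (+ (j ℕ.* n ℕ.+ a)) ^ suc k) (g j)) ⟩
      ∑[ j < m ] (∑[ a < n ] ((+ (j ℕ.* n ℕ.+ a)) ^ suc k) - ∑ n (g j))
        ≡⟨ ∑-distrib-- m (λ j → ∑[ a < n ] ((+ (j ℕ.* n ℕ.+ a)) ^ suc k)) (λ j → ∑ n (g j)) ⟩
      ∑[ j < m ] ∑[ a < n ] ((+ (j ℕ.* n ℕ.+ a)) ^ suc k) - ∑[ j < m ] ∑ n (g j)
        ≡⟨ cong₂ _-_ (∑-blocks m n (λ a → (+ a) ^ suc k)) (∑-cong m (λ j → sym (block j))) ⟨
      powerSum (suc k) (m ℕ.* n) - ∑[ j < m ] (powerSum (suc k) n + Q * + j)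
        ≡⟨ cong (_-_ (powerSum (suc k) (m ℕ.* n))) (∑-distrib-+ m (λ _ → powerSum (suc k) n) (λ j → Q * + j)) ⟩
      powerSum (suc k) (m ℕ.* n) - (∑[ j < m ] powerSum (suc k) n + ∑[ j < m ] (Q * + j))
        ≡⟨ cong (_-_ (powerSum (suc k) (m ℕ.* n))) (cong₂ _+_ (∑-const m (powerSum (suc k) n)) (∑-*ˡ m Q (λ j → + j))) ⟩
      powerSum (suc k) (m ℕ.* n) - (+ m * powerSum (suc k) n + Q * (∑[ j < m ] (+ j))) ∎

  powerSum-∣-multiple : ∀ k m n → + n ∣ powerSum (suc k) n → + n ∣ powerSum (suc k) (m ℕ.* n)
  powerSum-∣-multiple k m n n∣P = ≡mod-∣ (∣-trans (∣m⇒∣m*n (+ n) ∣-refl) (powerSum-blocks k m n))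
    (∣m∣n⇒∣m+n (∣n⇒∣m*n (+ m) n∣P)
               (∣m⇒∣m*n (∑[ j < m ] (+ j)) (∣m⇒∣m*n (powerSum k n) (∣n⇒∣m*n (+ suc k) ∣-refl))))

  powerSum-∣²-multiple : ∀ k m n → + n * + n ∣ powerSum (suc k) n → + n ∣ + suc k * powerSum k n →
                         + n * + n ∣ powerSum (suc k) (m ℕ.* n)
  powerSum-∣²-multiple k m n n²∣P n∣KP′ = ≡mod-∣ (powerSum-blocks k m n)
    (∣m∣n⇒∣m+n (∣n⇒∣m*n (+ m) n²∣P)
               (∣m⇒∣m*n (∑[ j < m ] (+ j))
                        (subst (+ n * + n ∣_) (factor (+ suc k) (+ n) (powerSum k n)) (*-monoʳ-∣ (+ n) n∣KP′))))
    where
    factor : ∀ K N P → N * (K * P) ≡ K * N * P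
    factor = solve-∀

  ∣-twice-powerSum-odd : ∀ h n → let k = suc (h ℕ.+ h) in + n ∣ powerSum k n + powerSum k n
  ∣-twice-powerSum-odd h n =
    subst (+ n ∣_) (unshift (powerSum k n) (+ n) W) (∣m∣n⇒∣m-n n∣twice[n+1] (∣m⇒∣m*n (W + W) ∣-refl))
    where
    k = suc (h ℕ.+ h)
    W = (+ n) ^ (h ℕ.+ h)
    n∣twice[n+1] : + n ∣ powerSum k (suc n) + powerSum k (suc n)
    n∣twice[n+1] = ≡mod-∣ (∣-trans (∣m⇒∣m*n (+ n) ∣-refl) (powerSum-reflection h n))
                          (∣m⇒∣m*n (powerSum (h ℕ.+ h) (suc n)) (∣n⇒∣m*n (+ k) ∣-refl))
    unshift : ∀ P N W → P + N * W + (P + N * W) - N * (W + W) ≡ P + P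
    unshift = solve-∀

  ∣²-twice-powerSum-odd : ∀ h n → let k = suc (suc h ℕ.+ suc h) in
    + n ∣ + k * powerSum (suc h ℕ.+ suc h) n → + n * + n ∣ powerSum k n + powerSum k n
  ∣²-twice-powerSum-odd h n n∣KP′ =
    subst (+ n * + n ∣_) (unshift (powerSum k n) (powerSum (suc h ℕ.+ suc h) n) (+ n) Z (+ k))
      (∣m∣n⇒∣m+n (∣m∣n⇒∣m+n (powerSum-reflection (suc h) n) (*-monoʳ-∣ (+ n) n∣KP′)) (∣m⇒∣m*n _ ∣-refl))
    where
    k = suc (suc h ℕ.+ suc h)
    Z = (+ n) ^ (h ℕ.+ suc h)
    unshift : ∀ P P′ N Z K → P + N * (N * Z) + (P + N * (N * Z)) - K * N * (P′ + N * Z) + N * (K * P′) + N * N * (K * Z - Z - Z)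
                           ≡ P + P
    unshift = solve-∀

  ∣-half : ∀ {d} u x → d ≡ 1ℤ + u + u → d ∣ x + x → d ∣ x
  ∣-half u x refl d∣2x = subst (_ ∣_) (cancel u x) (∣m∣n⇒∣m-n (∣n⇒∣m*n x ∣-refl) (∣n⇒∣m*n u d∣2x))
    where
    cancel : ∀ u x → x * (1ℤ + u + u) - u * (x + x) ≡ x
    cancel = solve-∀

  odd≡1+t+t : ∀ t → + suc (t ℕ.+ t) ≡ 1ℤ + + t + + t
  odd≡1+t+t t = trans (cong (_+_ 1ℤ) (ℤₚ.pos-+ t t)) (sym (ℤₚ.+-assoc 1ℤ (+ t) (+ t)))

  odd²≡1+u+u : ∀ t → let u = + t + + t + + t * + t + + t * + t in
    + suc (t ℕ.+ t) * + suc (t ℕ.+ t) ≡ 1ℤ + u + u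
  odd²≡1+u+u t rewrite odd≡1+t+t t = square (+ t)
    where
    square : ∀ t → (1ℤ + t + t) * (1ℤ + t + t) ≡ 1ℤ + (t + t + t * t + t * t) + (t + t + t * t + t * t)
    square = solve-∀

  pos-^ : ∀ a k → + (a ℕ.^ k) ≡ (+ a) ^ k
  pos-^ a zero    = refl
  pos-^ a (suc k) = trans (ℤₚ.pos-* a (a ℕ.^ k)) (cong (+ a *_) (pos-^ a k))

  S≡powerSum : ∀ k n → + S (suc k) n ≡ powerSum (suc k) n + (+ n) ^ suc k
  S≡powerSum k zero    = refl
  S≡powerSum k (suc n) = trans (ℤₚ.pos-+ (S (suc k) n) (suc n ℕ.^ suc k)) (cong₂ _+_ (S≡powerSum k n) (pos-^ (suc n) (suc k)))

  ∣⇒²∣^ : ∀ {d x} j → d ∣ x → d * d ∣ x ^ suc (suc j)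
  ∣⇒²∣^ {d} j (divides c refl) = divides (c * c * (c * d) ^ j) (regroup c d ((c * d) ^ j))
    where
    regroup : ∀ c d y → c * d * (c * d * y) ≡ c * c * y * (d * d)
    regroup = solve-∀

  -- n ∣ k P_{k-1}(n): the hypothesis that upgrades n ∣ S_k(mn) to n² ∣ S_k(mn).
  SquareCondition : ℕ → ℕ → Set
  SquareCondition n k = + n ∣ + k * powerSum (k ℕ.∸ 1) n

  prime-SquareCondition : ∀ {p} e → Prime p → InA p (suc (suc e)) → SquareCondition p (suc (suc e))
  prime-SquareCondition e pr inA = ∣n⇒∣m*n (+ suc (suc e)) (prime∣powerSum pr e inA)

  self-SquareCondition : ∀ n → SquareCondition n n
  self-SquareCondition n = ∣m⇒∣m*n (powerSum (n ℕ.∸ 1) n) ∣-refl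

  odd∣S : ∀ h t m → let n = suc (t ℕ.+ t) in n ∣ℕ S (suc (h ℕ.+ h)) (m ℕ.* n)
  odd∣S h t m = ∣⇒∣ᵤ (subst (+ n ∣_) (sym (S≡powerSum (h ℕ.+ h) (m ℕ.* n))) (∣m∣n⇒∣m+n n∣P n∣power))
    where
    n = suc (t ℕ.+ t)
    n∣P : + n ∣ powerSum (suc (h ℕ.+ h)) (m ℕ.* n)
    n∣P = powerSum-∣-multiple (h ℕ.+ h) m n (∣-half (+ t) _ (odd≡1+t+t t) (∣-twice-powerSum-odd h n))
    n∣power : + n ∣ (+ (m ℕ.* n)) ^ suc (h ℕ.+ h)
    n∣power = ∣m⇒∣m*n _ (subst (+ n ∣_) (sym (ℤₚ.pos-* m n)) (∣n⇒∣m*n (+ m) ∣-refl))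

  odd²∣S : ∀ h t m → let n = suc (t ℕ.+ t) ; k = suc (suc h ℕ.+ suc h) in
    SquareCondition n k → n ℕ.* n ∣ℕ S k (m ℕ.* n)
  odd²∣S h t m cond =
    ∣⇒∣ᵤ (subst₂ _∣_ (sym (ℤₚ.pos-* n n)) (sym (S≡powerSum (suc h ℕ.+ suc h) (m ℕ.* n)))
                     (∣m∣n⇒∣m+n n²∣P n²∣power))
    where
    n = suc (t ℕ.+ t)
    n²∣P : + n * + n ∣ powerSum (suc (suc h ℕ.+ suc h)) (m ℕ.* n)
    n²∣P = powerSum-∣²-multiple (suc h ℕ.+ suc h) m n
             (∣-half (+ t + + t + + t * + t + + t * + t) _ (odd²≡1+u+u t) (∣²-twice-powerSum-odd h n cond)) cond
    n²∣power : + n * + n ∣ (+ (m ℕ.* n)) ^ suc (suc h ℕ.+ suc h)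
    n²∣power = ∣⇒²∣^ (h ℕ.+ suc h) (subst (+ n ∣_) (sym (ℤₚ.pos-* m n)) (∣n⇒∣m*n (+ m) ∣-refl))

open import Defs
open import Data.Nat.Base using (ℕ; zero; suc; _+_; _*_; _^_; _≤_; s≤s; NonZero)
open import Data.Nat.Properties using (_≟_; +-suc; *-comm; *-identityˡ)
open import Data.Nat.Divisibility
  using (_∣_; divides; divides-refl; ∣-refl; ∣-trans; ∣m∣n⇒∣m+n; n∣m*n; *-monoʳ-∣; *-monoˡ-∣; *-cancelˡ-∣)
open import Data.Nat.Coprimality using (Coprime; coprime-divisor)
open import Data.Nat.Primality using (Prime; prime⇒irreducible; prime⇒nonZero)
open import Data.Nat.Tactic.RingSolver using (solve-∀)
open import Data.Product using (_×_; _,_; ∃-syntax)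
open import Data.Sum using (inj₁; inj₂)
open import Relation.Nullary using (¬_; Dec; yes; no; contradiction)
open import Relation.Binary.PropositionalEquality using (_≡_; _≢_; refl; sym; cong; subst)

-- Squares of distinct primes

distinct-primes-coprime : ∀ {p q} → Prime p → Prime q → p ≢ q → Coprime p q
distinct-primes-coprime pp pq p≢q (d∣p , d∣q) with prime⇒irreducible pp d∣p
... | inj₁ d≡1 = d≡1
... | inj₂ refl with prime⇒irreducible pq d∣q
...   | inj₁ refl = contradiction pp (λ ())
...   | inj₂ p≡q  = contradiction p≡q p≢q

coprime-square-divisor : ∀ {q m a} .{{_ : NonZero q}} → Coprime q m → q * q ∣ m * a → q * q ∣ a
coprime-square-divisor {q} {m} c q²∣ma with coprime-divisor c (∣-trans (n∣m*n q) q²∣ma)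
... | divides-refl b = *-monoˡ-∣ q (coprime-divisor c (*-cancelˡ-∣ q (subst (q * q ∣_) (regroup q m b) q²∣ma)))
  where
  regroup : ∀ q m b → m * (b * q) ≡ q * (m * b)
  regroup = solve-∀

squares-∣ : ∀ {p q x} → Prime p → Prime q → p ≢ q → p * p ∣ x → q * q ∣ x → (p * q) ^ 2 ∣ x
squares-∣ {p} {q} pp pq p≢q (divides-refl a) q²∣x = subst (_∣ a * (p * p)) (regroup p q) (*-monoˡ-∣ (p * p) q²∣a)
  where
  instance
    q≢0 : NonZero q
    q≢0 = prime⇒nonZero pq
  q⊥p : Coprime q p
  q⊥p = distinct-primes-coprime pq pp (λ q≡p → p≢q (sym q≡p))
  regroup : ∀ p q → q * q * (p * p) ≡ p * q * (p * q * 1)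
  regroup = solve-∀
  regroup′ : ∀ p a → a * (p * p) ≡ p * (p * a)
  regroup′ = solve-∀
  q²∣a : q * q ∣ a
  q²∣a = coprime-square-divisor q⊥p (coprime-square-divisor q⊥p (subst (q * q ∣_) (regroup′ p a) q²∣x))

odd⇒1+2t : ∀ {n} → ¬ (2 ∣ n) → ∃[ t ] n ≡ suc (t + t)
odd⇒1+2t {zero}        2∤n = contradiction (divides 0 refl) 2∤n
odd⇒1+2t {suc zero}    _   = 0 , refl
odd⇒1+2t {suc (suc n)} 2∤n with odd⇒1+2t {n} (λ 2∣n → 2∤n (∣m∣n⇒∣m+n ∣-refl 2∣n))
... | t , refl = suc t , cong (λ m → suc (suc m)) (sym (+-suc t t))

prime≢2⇒odd : ∀ {p} → Prime p → p ≢ 2 → ¬ (2 ∣ p)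
prime≢2⇒odd pp p≢2 2∣p with prime⇒irreducible pp 2∣p
... | inj₁ ()
... | inj₂ 2≡p = p≢2 (sym 2≡p)

theorem3p4 : (p q k : ℕ) → Prime p → Prime q → p ≢ 2 → q ≢ 2 → p ≢ q
    → 3 ≤ k → ¬ (2 ∣ k)
    → ((InA p k → ¬ InB q k → (p * q) ^ 2 ∣ S k (p * q))
       × (∀ d → IsD q k d → InA p k → (p * q) ^ 2 ∣ d * S k (p * q)))
theorem3p4 p q k pp pq p≢2 q≢2 p≢q 3≤k 2∤k
  with odd⇒1+2t (prime≢2⇒odd pp p≢2) | odd⇒1+2t (prime≢2⇒odd pq q≢2) | odd⇒1+2t 2∤k
... | _  , refl | _  , refl | zero  , refl = contradiction 3≤k λ { (s≤s ()) }
... | tp , refl | tq , refl | suc h , refl = part₁ , part₂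
  where
  p²∣S : InA p k → p * p ∣ S k (p * q)
  p²∣S inA = subst (λ x → p * p ∣ S k x) (*-comm q p) (odd²∣S h tp q (prime-SquareCondition _ pp inA))
  q²∣S : SquareCondition q k → q * q ∣ S k (p * q)
  q²∣S = odd²∣S h tq p
  part₁ : InA p k → ¬ InB q k → (p * q) ^ 2 ∣ S k (p * q)
  part₁ inA ¬inB = squares-∣ pp pq p≢q (p²∣S inA) (q²∣S (prime-SquareCondition _ pq ¬inB))
  part₂ : ∀ d → IsD q k d → InA p k → (p * q) ^ 2 ∣ d * S k (p * q)
  part₂ d (inj₁ (_ , _ , refl)) inA =
    squares-∣ pp pq p≢q (∣-trans (p²∣S inA) (n∣m*n q)) (*-monoʳ-∣ q (odd∣S (suc h) tq p))
  part₂ d (inj₂ (¬[inB∧k≢q] , refl)) inA = subst ((p * q) ^ 2 ∣_) (sym (*-identityˡ (S k (p * q)))) (d=1 (k ≟ q))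
    where
    d=1 : Dec (k ≡ q) → (p * q) ^ 2 ∣ S k (p * q)
    d=1 (yes k≡q) = squares-∣ pp pq p≢q (p²∣S inA) (q²∣S (subst (SquareCondition q) (sym k≡q) (self-SquareCondition q)))
    d=1 (no k≢q)  = part₁ inA (λ inB → ¬[inB∧k≢q] (inB , k≢q))
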